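{- Let $d_1,\dots,d_s$ be positive integers and $D=\operatorname{lcm}(d_1,\dots,d_s)$. Then $$I(d_1,\dots,d_s)=\frac{(-1)^s}{D}\sum_{m=1}^{D}\ \prod_{i:\, d_i\mid m}(1-d_i).$$
   Context: $I(d_1,\dots,d_s)$ is the number of $s$-tuples $(y_1,\dots,y_s)\in\mathbb{Z}^s$ with $1\le y_i\le d_i-1$ for all $i$ and $\frac{y_1}{d_1}+\cdots+\frac{y_s}{d_s}\equiv 0\pmod 1$. An empty product equals $1$. -}

module Defs where

open import Data.Nat as ℕ using (ℕ; zero; suc; _∸_)
open import Data.Nat.Divisibility using (_∣?_)
open import Data.Nat.LCM using (lcm)
open import Data.Fin using (Fin; zero; suc)
open import Data.List using (List; []; _∷_; map; concatMap; filter; length; upTo; foldr)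
open import Data.Integer as ℤ using (ℤ; +_)
open import Data.Rational as ℚ using (ℚ; _/_)
open import Relation.Binary.PropositionalEquality using (_≡_)
open import Relation.Nullary using (yes; no)
open import Relation.Unary using (Decidable)

range1 : ℕ → List ℕ
range1 n = map suc (upTo n)

tuples : (s : ℕ) → (Fin s → ℕ) → List (Fin s → ℕ)
tuples zero    d = (λ ()) ∷ []
tuples (suc s) d =
  concatMap (λ y₀ → map (λ ys → λ { zero → y₀ ; (suc i) → ys i })
                        (tuples s (λ i → d (suc i))))
            (range1 (d zero ∸ 1))

-- the rational number y / d (d ≥ 1 in all uses; value 0 for d = 0 is a dummy)
frac : ℕ → ℕ → ℚ
frac y zero    = ℚ.0ℚ
frac y (suc k) = (+ y) / suc k

fracSum : (s : ℕ) → (Fin s → ℕ) → (Fin s → ℕ) → ℚ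
fracSum zero    y d = ℚ.0ℚ
fracSum (suc s) y d = frac (y zero) (d zero) ℚ.+ fracSum s (λ i → y (suc i)) (λ i → d (suc i))

-- q ≡ 0 (mod 1), i.e. q is an integer (reduced denominator is 1)
IsInteger : ℚ → Set
IsInteger q = ℚ.denominatorℕ q ≡ 1

isInteger? : Decidable IsInteger
isInteger? q = ℚ.denominatorℕ q ℕ.≟ 1

I : (s : ℕ) → (Fin s → ℕ) → ℕ
I s d = length (filter (λ y → isInteger? (fracSum s y d)) (tuples s d))

lcmAll : (s : ℕ) → (Fin s → ℕ) → ℕ
lcmAll zero    d = 1
lcmAll (suc s) d = lcm (d zero) (lcmAll s (λ i → d (suc i)))

prodDiv : (s : ℕ) → (Fin s → ℕ) → ℕ → ℤ
prodDiv zero    d m = ℤ.1ℤ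
prodDiv (suc s) d m with d zero ∣? m
... | yes _ = (ℤ.1ℤ ℤ.- + d zero) ℤ.* prodDiv s (λ i → d (suc i)) m
... | no  _ = prodDiv s (λ i → d (suc i)) m

rhsSum : (s : ℕ) → (Fin s → ℕ) → ℤ
rhsSum s d = foldr ℤ._+_ ℤ.0ℤ (map (prodDiv s d) (range1 (lcmAll s d)))

sign : ℕ → ℤ
sign zero    = ℤ.1ℤ
sign (suc s) = ℤ.- sign s

{-# OPTIONS --safe #-}
-- Let M = lcm d and e i = M / d i. Then Σ yᵢ/dᵢ is an integer iff M ∣ Σ yᵢ eᵢ, so M · I counts
-- solutions of a linear congruence. Writing the range 1 ≤ yᵢ < dᵢ as 0 ≤ yᵢ < dᵢ minus yᵢ = 0 and
-- expanding by inclusion–exclusion, each subset S of indices contributes (∏_{i∈S} dᵢ) · h_S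
-- with h_S = gcd (M, eᵢ : i ∈ S): summing a divisibility condition g ∣ a + y e over a full
-- period 0 ≤ y < d replaces g by gcd g e. Since h_S = M / lcm (dᵢ : i ∈ S), this is the number
-- of multiples of lcm (dᵢ : i ∈ S) in [1, M] times ∏_{i∈S} dᵢ, which up to the overall sign
-- (−1)^s is the contribution of S to Σ_m ∏_{dᵢ ∣ m} (1 − dᵢ) once the product is expanded.
module Submission where

open import Defs

module Sums where
  open import Data.Nat as ℕ using (ℕ; zero; suc; _<_; z≤n; s≤s)
  import Data.Nat.Properties as ℕₚ
  open import Data.Integer using (ℤ; +_; 0ℤ; 1ℤ; _+_; _-_; _*_)
  open import Data.Integer.Properties
  open import Data.Integer.Solver using (module +-*-Solver)
  open import Data.List using (map; foldr; upTo; applyUpTo)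
  import Data.List.Properties as List
  open import Data.Empty using (⊥-elim)
  open import Function using (_∘_; _∘₂_)
  open import Relation.Nullary using (Dec; yes; no; ¬_)
  open import Relation.Nullary.Decidable using (_×-dec_)
  open import Relation.Unary using (Pred; Decidable)
  open import Relation.Binary.PropositionalEquality
  open +-*-Solver

  𝟙 : ∀ {p} {P : Set p} → Dec P → ℤ
  𝟙 (yes _) = 1ℤ
  𝟙 (no _)  = 0ℤ

  module _ {p} {P : Set p} where

    𝟙-yes : (P? : Dec P) → P → 𝟙 P? ≡ 1ℤ
    𝟙-yes (yes _) _  = refl
    𝟙-yes (no ¬p) p = ⊥-elim (¬p p)

    𝟙-no : (P? : Dec P) → ¬ P → 𝟙 P? ≡ 0ℤ
    𝟙-no (yes p) ¬p = ⊥-elim (¬p p)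
    𝟙-no (no _)  _  = refl

  module _ {p q} {P : Set p} {Q : Set q} where

    𝟙-cong : (P? : Dec P) (Q? : Dec Q) → (P → Q) → (Q → P) → 𝟙 P? ≡ 𝟙 Q?
    𝟙-cong P? (yes q) _   Q→P = 𝟙-yes P? (Q→P q)
    𝟙-cong P? (no ¬q) P→Q _   = 𝟙-no P? (¬q ∘ P→Q)

    𝟙-× : (P? : Dec P) (Q? : Dec Q) → 𝟙 (P? ×-dec Q?) ≡ 𝟙 P? * 𝟙 Q?
    𝟙-× (yes _) (yes _) = refl
    𝟙-× (yes _) (no _)  = refl
    𝟙-× (no _)  (yes _) = refl
    𝟙-× (no _)  (no _)  = refl

  ∑ : ℕ → (ℕ → ℤ) → ℤ
  ∑ zero    f = 0ℤ
  ∑ (suc n) f = f 0 + ∑ n (f ∘ suc)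

  ∑-syntax : ℕ → (ℕ → ℤ) → ℤ
  ∑-syntax = ∑

  infix 5 ∑-syntax
  syntax ∑-syntax n (λ y → e) = ∑[ y < n ] e

  ∑-cong : ∀ n {f g} → (∀ y → y < n → f y ≡ g y) → ∑ n f ≡ ∑ n g
  ∑-cong zero    f≡g = refl
  ∑-cong (suc n) f≡g = cong₂ _+_ (f≡g 0 (s≤s z≤n)) (∑-cong n (λ y y<n → f≡g (suc y) (s≤s y<n)))

  ∑-zero : ∀ n {f} → (∀ y → y < n → f y ≡ 0ℤ) → ∑ n f ≡ 0ℤ
  ∑-zero zero    f≡0 = refl
  ∑-zero (suc n) f≡0 =
    cong₂ _+_ (f≡0 0 (s≤s z≤n)) (∑-zero n (λ y y<n → f≡0 (suc y) (s≤s y<n)))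

  ∑-split : ∀ m n f → ∑ (m ℕ.+ n) f ≡ ∑ m f + (∑[ y < n ] f (m ℕ.+ y))
  ∑-split zero    n f = sym (+-identityˡ _)
  ∑-split (suc m) n f = trans (cong (_+_ (f 0)) (∑-split m n (f ∘ suc))) (sym (+-assoc (f 0) _ _))

  ∑-periodic : ∀ r q f → (∀ y → f (q ℕ.+ y) ≡ f y) → ∑ (r ℕ.* q) f ≡ + r * ∑ q f
  ∑-periodic zero    q f per = sym (*-zeroˡ (∑ q f))
  ∑-periodic (suc r) q f per = begin
    ∑ (q ℕ.+ r ℕ.* q) f                   ≡⟨ ∑-split q (r ℕ.* q) f ⟩
    ∑ q f + (∑[ y < r ℕ.* q ] f (q ℕ.+ y)) ≡⟨ cong (_+_ (∑ q f)) (∑-cong (r ℕ.* q) (λ y _ → per y)) ⟩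
    ∑ q f + ∑ (r ℕ.* q) f                 ≡⟨ cong (_+_ (∑ q f)) (∑-periodic r q f per) ⟩
    ∑ q f + + r * ∑ q f                   ≡⟨ solve 2 (λ x r → x :+ r :* x := (con 1ℤ :+ r) :* x)
                                                     refl (∑ q f) (+ r) ⟩
    + suc r * ∑ q f                       ∎
    where open ≡-Reasoning

  ∑-*ˡ : ∀ n c f → ∑[ y < n ] c * f y ≡ c * ∑ n f
  ∑-*ˡ zero    c f = sym (*-zeroʳ c)
  ∑-*ˡ (suc n) c f = trans (cong (_+_ (c * f 0)) (∑-*ˡ n c (f ∘ suc))) (sym (*-distribˡ-+ c (f 0) _))

  ∑-- : ∀ n f g → ∑[ y < n ] (f y - g y) ≡ ∑ n f - ∑ n g
  ∑-- zero    f g = refl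
  ∑-- (suc n) f g = trans (cong (_+_ (f 0 - g 0)) (∑-- n (f ∘ suc) (g ∘ suc)))
    (solve 4 (λ a b x y → a :- b :+ (x :- y) := a :+ x :- (b :+ y))
             refl (f 0) (g 0) (∑ n (f ∘ suc)) (∑ n (g ∘ suc)))

  ∑-𝟙-unique : ∀ {p} {P : Pred ℕ p} (P? : Decidable P) n {y₀} → y₀ < n → P y₀ →
               (∀ {y₁ y₂} → y₁ < n → y₂ < n → P y₁ → P y₂ → y₁ ≡ y₂) →
               ∑[ y < n ] 𝟙 (P? y) ≡ 1ℤ
  ∑-𝟙-unique P? (suc n) {zero} _ P0 unique =
    cong₂ _+_ (𝟙-yes (P? 0) P0) (∑-zero n {𝟙 ∘ P? ∘ suc} (λ y y<n → 𝟙-no (P? (suc y)) (λ Py →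
      ℕₚ.1+n≢0 (unique (s≤s y<n) (s≤s z≤n) Py P0))))
  ∑-𝟙-unique P? (suc n) {suc y₀} (s≤s y₀<n) Py₀ unique = begin
    𝟙 (P? 0) + (∑[ y < n ] 𝟙 (P? (suc y)))
      ≡⟨ cong (_+ ∑ n (𝟙 ∘ P? ∘ suc)) (𝟙-no (P? 0) (ℕₚ.1+n≢0 ∘ unique (s≤s y₀<n) (s≤s z≤n) Py₀)) ⟩
    0ℤ + (∑[ y < n ] 𝟙 (P? (suc y)))
      ≡⟨ +-identityˡ _ ⟩
    ∑[ y < n ] 𝟙 (P? (suc y))
      ≡⟨ ∑-𝟙-unique (P? ∘ suc) n y₀<n Py₀ (λ l₁ l₂ → ℕₚ.suc-injective ∘₂ unique (s≤s l₁) (s≤s l₂)) ⟩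
    1ℤ ∎
    where open ≡-Reasoning

  foldr-applyUpTo : ∀ n f → foldr _+_ 0ℤ (applyUpTo f n) ≡ ∑ n f
  foldr-applyUpTo zero    f = refl
  foldr-applyUpTo (suc n) f = cong (_+_ (f 0)) (foldr-applyUpTo n (f ∘ suc))

  foldr-range1 : ∀ n f → foldr _+_ 0ℤ (map f (range1 n)) ≡ ∑[ y < n ] f (suc y)
  foldr-range1 n f = trans
    (cong (foldr _+_ 0ℤ) (trans (sym (List.map-∘ (upTo n))) (List.map-upTo (f ∘ suc) n)))
    (foldr-applyUpTo n (f ∘ suc))

module Congruences where
  open import Data.Nat
  open import Data.Nat.Properties
  open import Data.Nat.Divisibility
  open import Data.Nat.DivMod using (m%n<n; m≡m%n+[m/n]*n; m/n*n≡m)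
  open import Data.Nat.GCD
  open import Data.Nat.LCM
  open import Data.Nat.Coprimality using (Coprime; coprime-Bézout; coprime-divisor; coprime-/gcd)
  open import Data.Integer as ℤ using (+_; 1ℤ)
  import Data.Integer.Properties as ℤₚ
  open import Data.Product using (∃-syntax; _,_; proj₁; proj₂)
  open import Data.Sum using (inj₁; inj₂)
  open import Function using (_∘_)
  open import Relation.Nullary using (yes; no; contradiction)
  open import Relation.Nullary.Decidable using (_×-dec_)
  open import Relation.Binary.PropositionalEquality
  open import Data.Nat.Solver using (module +-*-Solver)
  open +-*-Solver
  open Sums

  -- t = a·y or t = (q − 1)·a·y, according to which side of Bézout's identity carries the 1.
  linear-congruence-solvable : ∀ {q e} a .{{_ : NonZero q}} → Coprime q e → ∃[ t ] q ∣ a + t * e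
  linear-congruence-solvable {q@(suc q-1)} {e} a q⊥e with coprime-Bézout q⊥e
  ... | Bézout.+- x y 1+ye≡xq = a * y , divides (a * x) (begin
    a + a * y * e    ≡⟨ solve 3 (λ a y e → a :+ a :* y :* e := a :* (con 1 :+ y :* e)) refl a y e ⟩
    a * (1 + y * e)  ≡⟨ cong (a *_) 1+ye≡xq ⟩
    a * (x * q)      ≡⟨ sym (*-assoc a x q) ⟩
    a * x * q        ∎)
    where open ≡-Reasoning
  ... | Bézout.-+ x y 1+xq≡ye = q-1 * a * y , divides (a + q-1 * a * x) (begin
    a + q-1 * a * y * e        ≡⟨ cong (_+_ a) (*-assoc (q-1 * a) y e) ⟩
    a + q-1 * a * (y * e)      ≡⟨ cong (λ z → a + q-1 * a * z) (sym 1+xq≡ye) ⟩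
    a + q-1 * a * (1 + x * q)  ≡⟨ solve 3 (λ a p x → a :+ p :* a :* (con 1 :+ x :* (con 1 :+ p))
                                               := (a :+ p :* a :* x) :* (con 1 :+ p)) refl a q-1 x ⟩
    (a + q-1 * a * x) * q      ∎)
    where open ≡-Reasoning

  ∣-<⇒≡0 : ∀ {q n} → q ∣ n → n < q → n ≡ 0
  ∣-<⇒≡0 {n = zero}  _   _   = refl
  ∣-<⇒≡0 {n = suc n} q∣n n<q = contradiction q∣n (>⇒∤ n<q)

  linear-congruence-unique-≤ : ∀ {q e a y₁ y₂} → Coprime q e → y₁ ≤ y₂ → y₂ < q →
                               q ∣ a + y₁ * e → q ∣ a + y₂ * e → y₁ ≡ y₂
  linear-congruence-unique-≤ {q} {e} {a} {y₁} {y₂} q⊥e y₁≤y₂ y₂<q q∣₁ q∣₂ =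
    ≤-antisym y₁≤y₂ (m∸n≡0⇒m≤n (∣-<⇒≡0 q∣y₂∸y₁ (≤-<-trans (m∸n≤m y₂ y₁) y₂<q)))
    where
    split : a + y₂ * e ≡ a + y₁ * e + e * (y₂ ∸ y₁)
    split = begin
      a + y₂ * e                 ≡⟨ cong (λ z → a + z * e) (sym (m+[n∸m]≡n y₁≤y₂)) ⟩
      a + (y₁ + (y₂ ∸ y₁)) * e   ≡⟨ solve 4 (λ a y d e → a :+ (y :+ d) :* e := a :+ y :* e :+ e :* d)
                                          refl a y₁ (y₂ ∸ y₁) e ⟩
      a + y₁ * e + e * (y₂ ∸ y₁) ∎
      where open ≡-Reasoning
    q∣y₂∸y₁ : q ∣ y₂ ∸ y₁
    q∣y₂∸y₁ = coprime-divisor q⊥e (∣m+n∣m⇒∣n (subst (q ∣_) split q∣₂) q∣₁)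

  linear-congruence-unique : ∀ {q e a y₁ y₂} → Coprime q e → y₁ < q → y₂ < q →
                             q ∣ a + y₁ * e → q ∣ a + y₂ * e → y₁ ≡ y₂
  linear-congruence-unique {y₁ = y₁} {y₂} q⊥e y₁<q y₂<q q∣₁ q∣₂ with ≤-total y₁ y₂
  ... | inj₁ y₁≤y₂ = linear-congruence-unique-≤ q⊥e y₁≤y₂ y₂<q q∣₁ q∣₂
  ... | inj₂ y₂≤y₁ = sym (linear-congruence-unique-≤ q⊥e y₂≤y₁ y₁<q q∣₂ q∣₁)

  linear-congruence-reduce : ∀ {q e} a t .{{_ : NonZero q}} → q ∣ a + t * e → q ∣ a + t % q * e
  linear-congruence-reduce {q} {e} a t q∣ = ∣m+n∣m⇒∣n (subst (q ∣_) split q∣) (n∣m*n (t / q * e))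
    where
    split : a + t * e ≡ t / q * e * q + (a + t % q * e)
    split = begin
      a + t * e                     ≡⟨ cong (λ z → a + z * e) (m≡m%n+[m/n]*n t q) ⟩
      a + (t % q + t / q * q) * e   ≡⟨ solve 5 (λ a r d q e → a :+ (r :+ d :* q) :* e := d :* e :* q :+ (a :+ r :* e))
                                         refl a (t % q) (t / q) q e ⟩
      t / q * e * q + (a + t % q * e) ∎
      where open ≡-Reasoning

  ∑-𝟙-linear-congruence : ∀ {q e} a .{{_ : NonZero q}} → Coprime q e → ∀ r →
                          ∑[ y < r * q ] 𝟙 (q ∣? a + y * e) ≡ + r
  ∑-𝟙-linear-congruence {q} {e} a q⊥e r = begin
    ∑[ y < r * q ] 𝟙 (q ∣? a + y * e)       ≡⟨ ∑-periodic r q _ periodic ⟩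
    + r ℤ.* (∑[ y < q ] 𝟙 (q ∣? a + y * e)) ≡⟨ cong (+ r ℤ.*_) exactly-one ⟩
    + r ℤ.* 1ℤ                              ≡⟨ ℤₚ.*-identityʳ (+ r) ⟩
    + r                                     ∎
    where
    open ≡-Reasoning
    shift : ∀ y → a + (q + y) * e ≡ q * e + (a + y * e)
    shift y = solve 4 (λ a q y e → a :+ (q :+ y) :* e := q :* e :+ (a :+ y :* e)) refl a q y e
    periodic : ∀ y → 𝟙 (q ∣? a + (q + y) * e) ≡ 𝟙 (q ∣? a + y * e)
    periodic y = 𝟙-cong _ _ (λ q∣ → ∣m+n∣m⇒∣n (subst (q ∣_) (shift y) q∣) (m∣m*n e))
                            (λ q∣ → subst (q ∣_) (sym (shift y)) (∣m∣n⇒∣m+n (m∣m*n e) q∣))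
    exactly-one : ∑[ y < q ] 𝟙 (q ∣? a + y * e) ≡ 1ℤ
    exactly-one with t , q∣ ← linear-congruence-solvable a q⊥e =
      ∑-𝟙-unique (λ y → q ∣? a + y * e) q (m%n<n t q) (linear-congruence-reduce a t q∣)
                 (linear-congruence-unique q⊥e)

  𝟙-lcm-∣ : ∀ k d m → 𝟙 (lcm k d ∣? m) ≡ 𝟙 (k ∣? m) ℤ.* 𝟙 (d ∣? m)
  𝟙-lcm-∣ k d m = trans
    (𝟙-cong (lcm k d ∣? m) (k ∣? m ×-dec d ∣? m)
      (λ l∣m → ∣-trans (m∣lcm[m,n] k d) l∣m , ∣-trans (n∣lcm[m,n] k d) l∣m)
      (λ k∣m×d∣m → lcm-least (proj₁ k∣m×d∣m) (proj₂ k∣m×d∣m)))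
    (𝟙-× (k ∣? m) (d ∣? m))

  -- With g = M/k and e = M/d this says gcd(M/k, M/d) = M / lcm(k, d).
  gcd*lcm-cofactors : ∀ {M} g k e d .{{_ : NonZero d}} → g * k ≡ M → e * d ≡ M → gcd g e * lcm k d ≡ M
  gcd*lcm-cofactors {M} g k e d gk≡M ed≡M =
    *-cancelʳ-≡ _ _ (gcd k d) {{≢-nonZero (gcd[m,n]≢0 k d (inj₂ (≢-nonZero⁻¹ d)))}} (begin
      gcd g e * lcm k d * gcd k d       ≡⟨ solve 3 (λ a b c → a :* b :* c := a :* (c :* b))
                                                    refl (gcd g e) (lcm k d) (gcd k d) ⟩
      gcd g e * (gcd k d * lcm k d)     ≡⟨ cong (gcd g e *_) (gcd*lcm k d) ⟩
      gcd g e * (k * d)                 ≡⟨ *-comm (gcd g e) (k * d) ⟩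
      k * d * gcd g e                   ≡⟨ c*gcd[m,n]≡gcd[cm,cn] (k * d) g e ⟩
      gcd (k * d * g) (k * d * e)       ≡⟨ cong₂ gcd kdg≡Md kde≡Mk ⟩
      gcd (M * d) (M * k)               ≡⟨ sym (c*gcd[m,n]≡gcd[cm,cn] M d k) ⟩
      M * gcd d k                       ≡⟨ cong (M *_) (gcd-comm d k) ⟩
      M * gcd k d                       ∎)
    where
    open ≡-Reasoning
    kdg≡Md : k * d * g ≡ M * d
    kdg≡Md = trans (solve 3 (λ k d g → k :* d :* g := g :* k :* d) refl k d g) (cong (_* d) gk≡M)
    kde≡Mk : k * d * e ≡ M * k
    kde≡Mk = trans (solve 3 (λ k d e → k :* d :* e := e :* d :* k) refl k d e) (cong (_* k) ed≡M)

  -- Writing g = q h, e = e′ h with h = gcd g e, the condition g ∣ a + y e becomes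
  -- q ∣ a/h + y e′ with q, e′ coprime, and q ∣ n since g ∣ e n.
  ∑-𝟙-∣-progression : ∀ g e n a .{{_ : NonZero g}} → g ∣ e * n →
    ∑[ y < n ] (+ g ℤ.* 𝟙 (g ∣? a + y * e)) ≡ + n ℤ.* (+ gcd g e ℤ.* 𝟙 (gcd g e ∣? a))
  ∑-𝟙-∣-progression g e n a g∣en with gcd g e ∣? a
  ... | no h∤a = begin
    ∑[ y < n ] (+ g ℤ.* 𝟙 (g ∣? a + y * e))
      ≡⟨ ∑-zero n (λ y _ → trans (cong (+ g ℤ.*_) (𝟙-no _ (h∤a ∘ h∣a y))) (ℤₚ.*-zeroʳ (+ g))) ⟩
    ℤ.0ℤ
      ≡⟨ sym (trans (cong (+ n ℤ.*_) (ℤₚ.*-zeroʳ (+ gcd g e))) (ℤₚ.*-zeroʳ (+ n))) ⟩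
    + n ℤ.* (+ gcd g e ℤ.* ℤ.0ℤ)            ∎
    where
    open ≡-Reasoning
    h∣a : ∀ y → g ∣ a + y * e → gcd g e ∣ a
    h∣a y g∣ = ∣m+n∣m⇒∣n (subst (gcd g e ∣_) (+-comm a (y * e)) (∣-trans (gcd[m,n]∣m g e) g∣))
                         (∣n⇒∣m*n y (gcd[m,n]∣n g e))
  ... | yes h∣a = begin
    ∑[ y < n ] (+ g ℤ.* 𝟙 (g ∣? a + y * e))       ≡⟨ ∑-*ˡ n (+ g) _ ⟩
    + g ℤ.* (∑[ y < n ] 𝟙 (g ∣? a + y * e))
      ≡⟨ cong (λ m → + g ℤ.* (∑[ y < m ] 𝟙 (g ∣? a + y * e))) n≡rq ⟩
    + g ℤ.* (∑[ y < r * q ] 𝟙 (g ∣? a + y * e))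
      ≡⟨ cong (+ g ℤ.*_) (∑-cong (r * q) (λ y _ → cancel-h y)) ⟩
    + g ℤ.* (∑[ y < r * q ] 𝟙 (q ∣? a / h + y * e′))
      ≡⟨ cong (+ g ℤ.*_) (∑-𝟙-linear-congruence (a / h) q⊥e′ r) ⟩
    + g ℤ.* + r                                   ≡⟨ sym (ℤₚ.pos-* g r) ⟩
    + (g * r)                                     ≡⟨ cong +_ gr≡nh ⟩
    + (n * h)                                     ≡⟨ ℤₚ.pos-* n h ⟩
    + n ℤ.* + h                                   ≡⟨ cong (+ n ℤ.*_) (sym (ℤₚ.*-identityʳ (+ h))) ⟩
    + n ℤ.* (+ h ℤ.* 1ℤ)                          ∎
    where
    open ≡-Reasoning
    h : ℕ
    h = gcd g e
    instance
      h≢0 : NonZero h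
      h≢0 = ≢-nonZero (gcd[m,n]≢0 g e (inj₁ (≢-nonZero⁻¹ g)))
    q : ℕ
    q = g / h
    e′ : ℕ
    e′ = e / h
    instance
      q≢0 : NonZero q
      q≢0 = ≢-nonZero (m/gcd[m,n]≢0 g e)
    q⊥e′ : Coprime q e′
    q⊥e′ = coprime-/gcd g e
    qh≡g : q * h ≡ g
    qh≡g = m/n*n≡m (gcd[m,n]∣m g e)
    e′h≡e : e′ * h ≡ e
    e′h≡e = m/n*n≡m (gcd[m,n]∣n g e)
    q∣n : q ∣ n
    q∣n = coprime-divisor q⊥e′ (*-cancelʳ-∣ h (subst₂ _∣_ (sym qh≡g) en≡e′nh g∣en))
      where en≡e′nh : e * n ≡ e′ * n * h
            en≡e′nh = trans (cong (_* n) (sym e′h≡e))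
                           (solve 3 (λ e h n → e :* h :* n := e :* n :* h) refl e′ h n)
    r : ℕ
    r = n / q
    n≡rq : n ≡ r * q
    n≡rq = sym (m/n*n≡m q∣n)
    factor-h : ∀ y → a + y * e ≡ (a / h + y * e′) * h
    factor-h y = begin
      a + y * e                     ≡⟨ cong₂ (λ a e → a + y * e) (sym (m/n*n≡m h∣a)) (sym e′h≡e) ⟩
      a / h * h + y * (e′ * h)      ≡⟨ solve 4 (λ a h y e → a :* h :+ y :* (e :* h) := (a :+ y :* e) :* h)
                                                refl (a / h) h y e′ ⟩
      (a / h + y * e′) * h          ∎
    cancel-h : ∀ y → 𝟙 (g ∣? a + y * e) ≡ 𝟙 (q ∣? a / h + y * e′)
    cancel-h y = trans (cong₂ (λ m k → 𝟙 (m ∣? k)) (sym qh≡g) (factor-h y))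
                       (𝟙-cong _ _ (*-cancelʳ-∣ h) (*-monoˡ-∣ h))
    gr≡nh : g * r ≡ n * h
    gr≡nh = begin
      g * r        ≡⟨ cong (_* r) (sym qh≡g) ⟩
      q * h * r    ≡⟨ solve 3 (λ q h r → q :* h :* r := r :* q :* h) refl q h r ⟩
      r * q * h    ≡⟨ cong (_* h) (sym n≡rq) ⟩
      n * h        ∎

module Tuples where
  open import Data.Nat
  open import Data.Nat.Properties using (+-assoc; +-identityʳ)
  open import Data.Nat.Divisibility using (_∣_; _∣?_)
  open import Data.Fin using (Fin; zero; suc)
  open import Data.Vec.Functional using (tail)
  open import Data.Integer as ℤ using (+_; 0ℤ)
  import Data.Integer.Properties as ℤₚ
  open import Data.List using (List; []; _∷_; _++_; map; concatMap; filter; length; foldr)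
  import Data.List.Properties as List
  open import Data.Product using (_,_)
  open import Relation.Nullary using (yes; no)
  open import Relation.Unary using (Pred; Decidable)
  open import Relation.Binary.PropositionalEquality
  open import Function using (_∘′_)
  open Sums

  module _ {a p} {A : Set a} {P : Pred A p} (P? : Decidable P) where

    length-filter-[x] : ∀ x → + length (filter P? (x ∷ [])) ≡ 𝟙 (P? x)
    length-filter-[x] x with P? x
    ... | yes _ = refl
    ... | no _  = refl

    length-filter-map : ∀ {b} {B : Set b} (f : B → A) xs →
                        length (filter P? (map f xs)) ≡ length (filter (λ x → P? (f x)) xs)
    length-filter-map f []       = refl
    length-filter-map f (x ∷ xs) with P? (f x)
    ... | yes _ = cong suc (length-filter-map f xs)
    ... | no _  = length-filter-map f xs

    length-filter-concatMap : ∀ {b} {B : Set b} (f : B → List A) xs →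
      + length (filter P? (concatMap f xs)) ≡ foldr ℤ._+_ 0ℤ (map (λ x → + length (filter P? (f x))) xs)
    length-filter-concatMap f []       = refl
    length-filter-concatMap f (x ∷ xs) = begin
      + length (filter P? (f x ++ concatMap f xs))
        ≡⟨ cong (+_ ∘′ length) (List.filter-++ P? (f x) (concatMap f xs)) ⟩
      + length (filter P? (f x) ++ filter P? (concatMap f xs))
        ≡⟨ cong +_ (List.length-++ (filter P? (f x))) ⟩
      + (length (filter P? (f x)) + length (filter P? (concatMap f xs)))
        ≡⟨ ℤₚ.pos-+ (length (filter P? (f x))) _ ⟩
      + length (filter P? (f x)) ℤ.+ + length (filter P? (concatMap f xs))
        ≡⟨ cong (ℤ._+_ (+ length (filter P? (f x)))) (length-filter-concatMap f xs) ⟩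
      + length (filter P? (f x)) ℤ.+ foldr ℤ._+_ 0ℤ (map (λ x → + length (filter P? (f x))) xs) ∎
      where open ≡-Reasoning

  weightedSum : (s : ℕ) → (Fin s → ℕ) → (Fin s → ℕ) → ℕ
  weightedSum zero    y e = 0
  weightedSum (suc s) y e = y zero * e zero + weightedSum s (tail y) (tail e)

  #solutions : (s : ℕ) → (d e : Fin s → ℕ) → (g a : ℕ) → ℕ
  #solutions s d e g a = length (filter (λ y → g ∣? a + weightedSum s y e) (tuples s d))

  #solutions-zero : ∀ d e g a → + #solutions 0 d e g a ≡ 𝟙 (g ∣? a)
  #solutions-zero d e g a = trans (length-filter-[x] (λ y → g ∣? a + weightedSum 0 y e) (λ ()))
                                  (cong (λ x → 𝟙 (g ∣? x)) (+-identityʳ a))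

  #solutions-suc : ∀ s d e g a → + #solutions (suc s) d e g a ≡
    ∑[ y < d zero ∸ 1 ] + #solutions s (tail d) (tail e) g (a + suc y * e zero)
  #solutions-suc s d e g a =
    trans (length-filter-concatMap P? _ (range1 (d zero ∸ 1)))
   (trans (foldr-range1 (d zero ∸ 1) _)
          (∑-cong (d zero ∸ 1) (λ y₀ _ → cong +_
            (trans (length-filter-map P? _ (tuples s (tail d)))
                   (cong length (List.filter-≐ _ _ (reassoc (suc y₀) , reassoc′ (suc y₀)) (tuples s (tail d))))))))
    where
    P? : Decidable (λ y → g ∣ a + weightedSum (suc s) y e)
    P? y = g ∣? a + weightedSum (suc s) y e
    reassoc : ∀ y₀ {ys} → g ∣ a + (y₀ * e zero + weightedSum s ys (tail e)) →
              g ∣ a + y₀ * e zero + weightedSum s ys (tail e)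
    reassoc y₀ = subst (g ∣_) (sym (+-assoc a _ _))
    reassoc′ : ∀ y₀ {ys} → g ∣ a + y₀ * e zero + weightedSum s ys (tail e) →
               g ∣ a + (y₀ * e zero + weightedSum s ys (tail e))
    reassoc′ y₀ = subst (g ∣_) (+-assoc a _ _)

module Rationals where
  open import Data.Nat as ℕ using (ℕ; zero; suc; NonZero; _*_)
  open import Data.Nat.Properties using (*-zeroʳ; *-assoc)
  open import Data.Nat.Divisibility using (_∣_; divides; ∣-refl)
  open import Data.Nat.Coprimality using (recompute)
  open import Data.Fin using (zero; suc)
  open import Data.Vec.Functional using (tail)
  open import Data.Integer as ℤ using (+_)
  import Data.Integer.Properties as ℤₚ
  open import Data.Integer.Solver using (module +-*-Solver)
  open import Data.Rational using (mkℚ; toℚᵘ)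
  import Data.Rational.Properties as ℚₚ
  open import Data.Rational.Unnormalised as ℚᵘ using (mkℚᵘ; *≡*; _≃_; _/_)
  import Data.Rational.Unnormalised.Properties as ℚᵘₚ
  open import Data.List using (length)
  import Data.List.Properties as List
  open import Data.Product using (_,_)
  open import Function using (_∘_)
  open import Relation.Nullary using (contradiction)
  open import Relation.Binary.PropositionalEquality
  open +-*-Solver
  open Tuples using (weightedSum; #solutions)

  frac≃ : ∀ {M} y {d e} .{{_ : NonZero M}} → e * d ≡ M → toℚᵘ (frac y d) ≃ + (y * e) / M
  frac≃ {suc M-1} y {zero} {e} ed≡M = contradiction (trans (sym (*-zeroʳ e)) ed≡M) (λ ())
  frac≃ {M@(suc _)} y {d@(suc d-1)} {e} ed≡M =
    ℚᵘₚ.≃-trans (ℚₚ.toℚᵘ-fromℚᵘ (mkℚᵘ (+ y) d-1)) (*≡* (begin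
      + y ℤ.* + M            ≡⟨ sym (ℤₚ.pos-* y M) ⟩
      + (y * M)              ≡⟨ cong (λ z → + (y * z)) (sym ed≡M) ⟩
      + (y * (e * d))        ≡⟨ cong +_ (sym (*-assoc y e d)) ⟩
      + (y * e * d)          ≡⟨ ℤₚ.pos-* (y * e) d ⟩
      + (y * e) ℤ.* + d      ∎))
    where open ≡-Reasoning

  +-/ : ∀ {M} a b .{{_ : NonZero M}} → (+ a / M) ℚᵘ.+ (+ b / M) ≃ + (a ℕ.+ b) / M
  +-/ {M@(suc _)} a b = *≡* (begin
    (+ a ℤ.* + M ℤ.+ + b ℤ.* + M) ℤ.* + M  ≡⟨ solve 3 (λ a b m → (a :* m :+ b :* m) :* m := (a :+ b) :* (m :* m))
                                                     refl (+ a) (+ b) (+ M) ⟩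
    (+ a ℤ.+ + b) ℤ.* (+ M ℤ.* + M)        ≡⟨ cong₂ ℤ._*_ (sym (ℤₚ.pos-+ a b)) (sym (ℤₚ.pos-* M M)) ⟩
    + (a ℕ.+ b) ℤ.* + (M * M)              ∎)
    where open ≡-Reasoning

  fracSum≃ : ∀ {M} s d e .{{_ : NonZero M}} → (∀ i → e i * d i ≡ M) →
             ∀ y → toℚᵘ (fracSum s y d) ≃ + weightedSum s y e / M
  fracSum≃ {suc _} zero    d e ed≡M y = *≡* refl
  fracSum≃ {M}     (suc s) d e ed≡M y =
    ℚᵘₚ.≃-trans (ℚₚ.toℚᵘ-homo-+ (frac (y zero) (d zero)) (fracSum s (tail y) (tail d)))
   (ℚᵘₚ.≃-trans (ℚᵘₚ.+-cong (frac≃ (y zero) (ed≡M zero))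
                            (fracSum≃ s (tail d) (tail e) (ed≡M ∘ suc) (tail y)))
                (+-/ (y zero * e zero) (weightedSum s (tail y) (tail e))))

  isInteger⇒∣ : ∀ {M} q N .{{_ : NonZero M}} → toℚᵘ q ≃ + N / M → IsInteger q → M ∣ N
  isInteger⇒∣ {M@(suc _)} (mkℚ n zero _) N (*≡* n*M≡N*1) refl = divides ℤ.∣ n ∣ (begin
    N                   ≡⟨ cong ℤ.∣_∣ (sym (trans n*M≡N*1 (ℤₚ.*-identityʳ (+ N)))) ⟩
    ℤ.∣ n ℤ.* + M ∣     ≡⟨ ℤₚ.abs-* n (+ M) ⟩
    ℤ.∣ n ∣ * M         ∎)
    where open ≡-Reasoning

  -- The reduced denominator divides the numerator, so by coprimality it is 1.
  ∣⇒isInteger : ∀ {M} q N .{{_ : NonZero M}} → toℚᵘ q ≃ + N / M → M ∣ N → IsInteger q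
  ∣⇒isInteger {M@(suc _)} (mkℚ n d-1 n⊥d) N (*≡* n*M≡N*d) (divides k N≡kM) = recompute n⊥d (d∣n , ∣-refl)
    where
    open ≡-Reasoning
    d : ℕ
    d = suc d-1
    n≡kd : n ≡ + k ℤ.* + d
    n≡kd = ℤₚ.*-cancelʳ-≡ n (+ k ℤ.* + d) (+ M) (begin
      n ℤ.* + M               ≡⟨ n*M≡N*d ⟩
      + N ℤ.* + d             ≡⟨ cong (λ z → + z ℤ.* + d) N≡kM ⟩
      + (k * M) ℤ.* + d       ≡⟨ cong (ℤ._* + d) (ℤₚ.pos-* k M) ⟩
      + k ℤ.* + M ℤ.* + d     ≡⟨ solve 3 (λ k m d → k :* m :* d := k :* d :* m) refl (+ k) (+ M) (+ d) ⟩
      + k ℤ.* + d ℤ.* + M     ∎)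
    d∣n : d ∣ ℤ.∣ n ∣
    d∣n = divides k (trans (cong ℤ.∣_∣ n≡kd) (ℤₚ.abs-* (+ k) (+ d)))

  I≡#solutions : ∀ {M} s d e .{{_ : NonZero M}} → (∀ i → e i * d i ≡ M) → I s d ≡ #solutions s d e M 0
  I≡#solutions s d e ed≡M = cong length (List.filter-≐ _ _
    ((λ {y} → isInteger⇒∣ (fracSum s y d) _ (fracSum≃ s d e ed≡M y)) ,
     (λ {y} → ∣⇒isInteger (fracSum s y d) _ (fracSum≃ s d e ed≡M y)))
    (tuples s d))

open import Data.Nat as ℕ using (ℕ; zero; suc; NonZero; _≤_; _∸_)
import Data.Nat.Properties as ℕₚ
open import Data.Nat.Divisibility
  using (_∣_; _∣?_; divides; quotient; m∣n⇒n≡quotient*m; ∣-refl; ∣-trans; 0∣⇒≡0; _∣0; 1∣_)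
open import Data.Nat.GCD using (gcd; gcd[m,n]∣m; gcd[m,n]≢0; gcd-assoc; gcd-comm)
open import Data.Nat.LCM using (lcm; m∣lcm[m,n]; n∣lcm[m,n]; gcd*lcm)
open import Data.Nat.Coprimality as Coprime using (1-coprimeTo)
open import Data.Fin using (Fin; zero; suc)
open import Data.Vec.Functional using (tail)
open import Data.Integer using (ℤ; +_; _+_; _-_; _*_; -_; 1ℤ)
import Data.Integer.Properties as ℤₚ
open import Data.Integer.Solver using (module +-*-Solver)
open import Data.Sum using (inj₁)
open import Function using (_∘_)
open import Relation.Nullary using (yes; no; contradiction)
open import Relation.Binary.PropositionalEquality
open +-*-Solver
open Sums
open Congruences using (∑-𝟙-linear-congruence; 𝟙-lcm-∣; gcd*lcm-cofactors; ∑-𝟙-∣-progression)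
open Tuples using (#solutions; #solutions-zero; #solutions-suc)
open Rationals using (I≡#solutions)

divisor-nonZero : ∀ {m n} .{{_ : NonZero n}} → m ∣ n → NonZero m
divisor-nonZero {zero}  {n} 0∣n = contradiction (0∣⇒≡0 0∣n) (ℕ.≢-nonZero⁻¹ n)
divisor-nonZero {suc _}     _   = _

gcd-nonZero : ∀ m n .{{_ : NonZero m}} → NonZero (gcd m n)
gcd-nonZero m n = ℕ.≢-nonZero (gcd[m,n]≢0 m n (inj₁ (ℕ.≢-nonZero⁻¹ m)))

lcm-nonZero : ∀ m n .{{_ : NonZero m}} .{{_ : NonZero n}} → NonZero (lcm m n)
lcm-nonZero m n = ℕₚ.m*n≢0⇒n≢0 (gcd m n) {{subst NonZero (sym (gcd*lcm m n)) (ℕₚ.m*n≢0 m n)}}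

lcmAll-nonZero : ∀ s d → (∀ i → 1 ≤ d i) → NonZero (lcmAll s d)
lcmAll-nonZero zero    d d≥1 = _
lcmAll-nonZero (suc s) d d≥1 =
  lcm-nonZero (d zero) (lcmAll s (tail d)) {{ℕ.>-nonZero (d≥1 zero)}} {{lcmAll-nonZero s (tail d) (d≥1 ∘ suc)}}

d∣lcmAll : ∀ s d i → d i ∣ lcmAll s d
d∣lcmAll (suc s) d zero    = m∣lcm[m,n] (d zero) _
d∣lcmAll (suc s) d (suc i) = ∣-trans (d∣lcmAll s (tail d) i) (n∣lcm[m,n] (d zero) _)

prodDiv-suc : ∀ s d m → prodDiv (suc s) d m ≡ (1ℤ - + d zero * 𝟙 (d zero ∣? m)) * prodDiv s (tail d) m
prodDiv-suc s d m with d zero ∣? m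
... | yes _ = cong (λ x → (1ℤ - x) * prodDiv s (tail d) m) (sym (ℤₚ.*-identityʳ (+ d zero)))
... | no _  = sym (trans (cong (λ x → (1ℤ - x) * prodDiv s (tail d) m) (ℤₚ.*-zeroʳ (+ d zero)))
                         (ℤₚ.*-identityˡ (prodDiv s (tail d) m)))

-- Φ s d e g a = ∑_{S ⊆ {1,…,s}} (−1)^(s − |S|) (∏_{i ∈ S} d i) h_S [h_S ∣ a]
-- with h_S = gcd (g, e i : i ∈ S).
Φ : (s : ℕ) → (d e : Fin s → ℕ) → (g a : ℕ) → ℤ
Φ zero    d e g a = + g * 𝟙 (g ∣? a)
Φ (suc s) d e g a = + d zero * Φ s (tail d) (tail e) (gcd g (e zero)) a - Φ s (tail d) (tail e) g a

Ψ : (M s : ℕ) → (Fin s → ℕ) → ℕ → ℤ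
Ψ M s d k = ∑[ y < M ] (𝟙 (k ∣? suc y) * prodDiv s d (suc y))

∑-Φ-progression : ∀ s d e g n f a .{{_ : NonZero g}} → g ∣ f ℕ.* n →
  ∑[ y < n ] Φ s d e g (a ℕ.+ y ℕ.* f) ≡ + n * Φ s d e (gcd g f) a
∑-Φ-progression zero    d e g n f a g∣fn = ∑-𝟙-∣-progression g f n a g∣fn
∑-Φ-progression (suc s) d e g n f a g∣fn = begin
  ∑[ y < n ] (+ d zero * Φ′ g′ (a ℕ.+ y ℕ.* f) - Φ′ g (a ℕ.+ y ℕ.* f))
    ≡⟨ ∑-- n _ _ ⟩
  (∑[ y < n ] (+ d zero * Φ′ g′ (a ℕ.+ y ℕ.* f))) - (∑[ y < n ] Φ′ g (a ℕ.+ y ℕ.* f))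
    ≡⟨ cong (_- (∑[ y < n ] Φ′ g (a ℕ.+ y ℕ.* f))) (∑-*ˡ n (+ d zero) _) ⟩
  + d zero * (∑[ y < n ] Φ′ g′ (a ℕ.+ y ℕ.* f)) - (∑[ y < n ] Φ′ g (a ℕ.+ y ℕ.* f))
    ≡⟨ cong₂ (λ u v → + d zero * u - v)
             (∑-Φ-progression s (tail d) (tail e) g′ n f a {{gcd-nonZero g (e zero)}}
                              (∣-trans (gcd[m,n]∣m g (e zero)) g∣fn))
             (∑-Φ-progression s (tail d) (tail e) g n f a g∣fn) ⟩
  + d zero * (+ n * Φ′ (gcd g′ f) a) - + n * Φ′ (gcd g f) a
    ≡⟨ cong (λ h → + d zero * (+ n * Φ′ h a) - + n * Φ′ (gcd g f) a) gcd-swap ⟩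
  + d zero * (+ n * Φ′ (gcd (gcd g f) (e zero)) a) - + n * Φ′ (gcd g f) a
    ≡⟨ solve 4 (λ x y u v → x :* (y :* u) :- y :* v := y :* (x :* u :- v))
               refl (+ d zero) (+ n) (Φ′ (gcd (gcd g f) (e zero)) a) (Φ′ (gcd g f) a) ⟩
  + n * (+ d zero * Φ′ (gcd (gcd g f) (e zero)) a - Φ′ (gcd g f) a) ∎
  where
  open ≡-Reasoning
  Φ′ : ℕ → ℕ → ℤ
  Φ′ = Φ s (tail d) (tail e)
  g′ : ℕ
  g′ = gcd g (e zero)
  gcd-swap : gcd (gcd g (e zero)) f ≡ gcd (gcd g f) (e zero)
  gcd-swap = trans (gcd-assoc g (e zero) f) (trans (cong (gcd g) (gcd-comm (e zero) f)) (sym (gcd-assoc g f (e zero))))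

Ψ-suc : ∀ M s d k → Ψ M (suc s) d k ≡ Ψ M s (tail d) k - + d zero * Ψ M s (tail d) (lcm k (d zero))
Ψ-suc M s d k = begin
  Ψ M (suc s) d k
    ≡⟨ ∑-cong M (λ y _ → pointwise (suc y)) ⟩
  ∑[ y < M ] (𝟙 (k ∣? suc y) * P (suc y) - + d zero * (𝟙 (lcm k (d zero) ∣? suc y) * P (suc y)))
    ≡⟨ ∑-- M _ _ ⟩
  Ψ M s (tail d) k - (∑[ y < M ] (+ d zero * (𝟙 (lcm k (d zero) ∣? suc y) * P (suc y))))
    ≡⟨ cong (_-_ (Ψ M s (tail d) k)) (∑-*ˡ M (+ d zero) _) ⟩
  Ψ M s (tail d) k - + d zero * Ψ M s (tail d) (lcm k (d zero)) ∎
  where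
  open ≡-Reasoning
  P : ℕ → ℤ
  P = prodDiv s (tail d)
  pointwise : ∀ m → 𝟙 (k ∣? m) * prodDiv (suc s) d m ≡
                    𝟙 (k ∣? m) * P m - + d zero * (𝟙 (lcm k (d zero) ∣? m) * P m)
  pointwise m = begin
    𝟙 (k ∣? m) * prodDiv (suc s) d m
      ≡⟨ cong (𝟙 (k ∣? m) *_) (prodDiv-suc s d m) ⟩
    𝟙 (k ∣? m) * ((1ℤ - + d zero * 𝟙 (d zero ∣? m)) * P m)
      ≡⟨ solve 4 (λ i x j p → i :* ((con 1ℤ :- x :* j) :* p) := i :* p :- x :* (i :* j :* p))
                 refl (𝟙 (k ∣? m)) (+ d zero) (𝟙 (d zero ∣? m)) (P m) ⟩
    𝟙 (k ∣? m) * P m - + d zero * (𝟙 (k ∣? m) * 𝟙 (d zero ∣? m) * P m)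
      ≡⟨ cong (λ x → 𝟙 (k ∣? m) * P m - + d zero * (x * P m)) (sym (𝟙-lcm-∣ k (d zero) m)) ⟩
    𝟙 (k ∣? m) * P m - + d zero * (𝟙 (lcm k (d zero) ∣? m) * P m) ∎

rhsSum≡Ψ : ∀ s d → rhsSum s d ≡ Ψ (lcmAll s d) s d 1
rhsSum≡Ψ s d = trans (foldr-range1 (lcmAll s d) (prodDiv s d))
  (∑-cong (lcmAll s d) (λ y _ → sym (trans (cong (_* prodDiv s d (suc y)) (𝟙-yes (1 ∣? suc y) (1∣ suc y)))
                                           (ℤₚ.*-identityˡ (prodDiv s d (suc y))))))

module _ {M} .{{_ : NonZero M}} where

  Φ-counts : ∀ s d e → (∀ i → e i ℕ.* d i ≡ M) → ∀ g a → g ∣ M →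
             + g * + #solutions s d e g a ≡ Φ s d e g a
  Φ-counts zero    d e ed≡M g a g∣M = cong (+ g *_) (#solutions-zero d e g a)
  Φ-counts (suc s) d e ed≡M g a g∣M = begin
    + g * + #solutions (suc s) d e g a
      ≡⟨ cong (+ g *_) (#solutions-suc s d e g a) ⟩
    + g * (∑[ y < d zero ∸ 1 ] + #solutions s (tail d) (tail e) g (a′ (suc y)))
      ≡⟨ sym (∑-*ˡ (d zero ∸ 1) (+ g) _) ⟩
    ∑[ y < d zero ∸ 1 ] (+ g * + #solutions s (tail d) (tail e) g (a′ (suc y)))
      ≡⟨ ∑-cong (d zero ∸ 1) (λ y _ → Φ-counts s (tail d) (tail e) (ed≡M ∘ suc) g (a′ (suc y)) g∣M) ⟩
    X
      ≡⟨ solve 2 (λ x p → x := p :+ x :- p) refl X (Φ′ a) ⟩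
    Φ′ a + X - Φ′ a
      ≡⟨ cong (_- Φ′ a) full-period ⟩
    + d zero * Φ s (tail d) (tail e) (gcd g (e zero)) a - Φ′ a ∎
    where
    open ≡-Reasoning
    instance
      g≢0 : NonZero g
      g≢0 = divisor-nonZero g∣M
      d₀≢0 : NonZero (d zero)
      d₀≢0 = divisor-nonZero (divides (e zero) (sym (ed≡M zero)))
    a′ : ℕ → ℕ
    a′ y = a ℕ.+ y ℕ.* e zero
    Φ′ : ℕ → ℤ
    Φ′ = Φ s (tail d) (tail e) g
    X : ℤ
    X = ∑[ y < d zero ∸ 1 ] Φ′ (a′ (suc y))
    suc-∸1 : ∀ n .{{_ : NonZero n}} → suc (n ∸ 1) ≡ n
    suc-∸1 (suc n) = refl
    -- The term y = 0, missing from the range 1 ≤ y < d₀, completes a full period.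
    full-period : Φ′ a + X ≡ + d zero * Φ s (tail d) (tail e) (gcd g (e zero)) a
    full-period = begin
      Φ′ a + X                           ≡⟨ cong (λ x → Φ′ x + X) (sym (ℕₚ.+-identityʳ a)) ⟩
      ∑[ y < suc (d zero ∸ 1) ] Φ′ (a′ y) ≡⟨ cong (λ n → ∑[ y < n ] Φ′ (a′ y)) (suc-∸1 (d zero)) ⟩
      ∑[ y < d zero ] Φ′ (a′ y)          ≡⟨ ∑-Φ-progression s (tail d) (tail e) g (d zero) (e zero) a
                                              (subst (g ∣_) (sym (ed≡M zero)) g∣M) ⟩
      + d zero * Φ s (tail d) (tail e) (gcd g (e zero)) a ∎

  Φ-at-zero : ∀ s d e → (∀ i → e i ℕ.* d i ≡ M) → ∀ g k → g ℕ.* k ≡ M →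
              Φ s d e g 0 ≡ sign s * Ψ M s d k
  -- The multiples of k in [1, g k] are counted as the solutions of k ∣ 1 + y · 1.
  Φ-at-zero zero d e ed≡M g k gk≡M = begin
    + g * 𝟙 (g ∣? 0)                    ≡⟨ cong (+ g *_) (𝟙-yes (g ∣? 0) (g ∣0)) ⟩
    + g * 1ℤ                            ≡⟨ ℤₚ.*-identityʳ (+ g) ⟩
    + g                                 ≡⟨ sym (∑-𝟙-linear-congruence 1 (Coprime.sym (1-coprimeTo k)) g) ⟩
    ∑[ y < g ℕ.* k ] 𝟙 (k ∣? 1 ℕ.+ y ℕ.* 1)
                                        ≡⟨ cong (λ n → ∑[ y < n ] 𝟙 (k ∣? 1 ℕ.+ y ℕ.* 1)) gk≡M ⟩
    ∑[ y < M ] 𝟙 (k ∣? 1 ℕ.+ y ℕ.* 1)   ≡⟨ ∑-cong M (λ y _ → sym (trans (ℤₚ.*-identityʳ _)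
                                               (cong (λ x → 𝟙 (k ∣? suc x)) (sym (ℕₚ.*-identityʳ y))))) ⟩
    Ψ M zero d k                        ≡⟨ sym (ℤₚ.*-identityˡ (Ψ M zero d k)) ⟩
    sign zero * Ψ M zero d k            ∎
    where
    open ≡-Reasoning
    instance
      k≢0 : NonZero k
      k≢0 = divisor-nonZero (divides g (sym gk≡M))
  Φ-at-zero (suc s) d e ed≡M g k gk≡M = begin
    + d zero * Φ s (tail d) (tail e) (gcd g (e zero)) 0 - Φ s (tail d) (tail e) g 0
      ≡⟨ cong₂ (λ u v → + d zero * u - v)
               (Φ-at-zero s (tail d) (tail e) (ed≡M ∘ suc) (gcd g (e zero)) (lcm k (d zero))
                         (gcd*lcm-cofactors g k (e zero) (d zero) gk≡M (ed≡M zero)))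
               (Φ-at-zero s (tail d) (tail e) (ed≡M ∘ suc) g k gk≡M) ⟩
    + d zero * (sign s * Ψ′ (lcm k (d zero))) - sign s * Ψ′ k
      ≡⟨ solve 4 (λ x σ a b → x :* (σ :* a) :- σ :* b := (:- σ) :* (b :- x :* a))
                 refl (+ d zero) (sign s) (Ψ′ (lcm k (d zero))) (Ψ′ k) ⟩
    - sign s * (Ψ′ k - + d zero * Ψ′ (lcm k (d zero)))
      ≡⟨ cong (- sign s *_) (sym (Ψ-suc M s d k)) ⟩
    - sign s * Ψ M (suc s) d k ∎
    where
    open ≡-Reasoning
    Ψ′ : ℕ → ℤ
    Ψ′ = Ψ M s (tail d)
    instance
      d₀≢0 : NonZero (d zero)
      d₀≢0 = divisor-nonZero (divides (e zero) (sym (ed≡M zero)))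

lemma2p10 : (s : ℕ) (d : Fin s → ℕ) → (∀ i → 1 ≤ d i) →
    + lcmAll s d * + I s d ≡ sign s * rhsSum s d
lemma2p10 s d d≥1 = begin
  + M * + I s d                 ≡⟨ cong (λ n → + M * + n) (I≡#solutions s d e ed≡M) ⟩
  + M * + #solutions s d e M 0  ≡⟨ Φ-counts s d e ed≡M M 0 ∣-refl ⟩
  Φ s d e M 0                   ≡⟨ Φ-at-zero s d e ed≡M M 1 (ℕₚ.*-identityʳ M) ⟩
  sign s * Ψ M s d 1            ≡⟨ cong (sign s *_) (sym (rhsSum≡Ψ s d)) ⟩
  sign s * rhsSum s d           ∎
  where
  open ≡-Reasoning
  M : ℕ
  M = lcmAll s d
  instance
    M≢0 : NonZero M
    M≢0 = lcmAll-nonZero s d d≥1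
  e : Fin s → ℕ
  e i = quotient (d∣lcmAll s d i)
  ed≡M : ∀ i → e i ℕ.* d i ≡ M
  ed≡M i = sym (m∣n⇒n≡quotient*m (d∣lcmAll s d i))
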